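{- In the decremental algorithm $\mathcal{B}$ (described in the context), the graph $T$ computed by the procedure RepairTree is a tree.
   Context: Let $G$ be an unweighted undirected network with root $s$ undergoing edge deletions; $G$ denotes the current graph. Algorithm $\mathcal{B}$ has parameters $\kappa\geq 1$, $X\geq 1$ and $\delta\geq 1$, and works in phases. At the start of a phase it lets $G_0$ be the current graph, computes a BFS tree $T_0$ of $G_0$ rooted at $s$ up to depth $X$ and the distances $d_{G_0}(\cdot,s)$, sets $k=0$, $T=T_0$, $F_0=T_0$. On deletion of an edge $(u,v)$: $k$ is incremented; if $k$ reaches $\kappa$ a new phase starts; otherwise $(u,v)$ is removed from $F_0$ (if present) and RepairTree is called, and if it reports "distance increase" a new phase starts. RepairTree: set $F=F_0$; let $U$ be the set of nodes of $T_0$ other than $s$ having no parent in $F$. For each $u\in U$, perform a breadth-first search in $G$ from $u$ up to depth $\delta$ looking for a node $v$ with (1) $d_{G_0}(v,s)<d_{G_0}(u,s)$ and (2) $d_G(u,v)\leq\delta$; if such $v$ is found, add to $F$ the edge $(u,v)$ (making $v$ the parent of $u$) with weight $d_G(u,v)$; otherwise return "distance increase". If all searches succeed, set $T=F$ and return it. -}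

module Defs where

open import Data.Nat using (ℕ; zero; suc; _≤_; _<_)
open import Data.Fin using (Fin)
open import Data.Product using (Σ; ∃; _×_; _,_)
open import Data.Sum using (_⊎_)
open import Data.List using (List; []; _∷_; length; _++_; take)
open import Data.List.Membership.Propositional using (_∈_)
open import Data.List.Relation.Unary.Linked using (Linked)
open import Data.List.Relation.Unary.Unique.Propositional using (Unique)
open import Relation.Nullary using (¬_)
open import Relation.Binary.PropositionalEquality using (_≡_)

Graph : ℕ → Set₁
Graph n = Fin n → Fin n → Set

data Walk {n : ℕ} (E : Graph n) : Fin n → Fin n → ℕ → Set where
  here : ∀ {x} → Walk E x x 0
  step : ∀ {x y z k} → E x y → Walk E y z k → Walk E x z (suc k)

-- d_E(x , y) = k   (shortest-walk distance; an unreachable pair has no k)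
Dist : ∀ {n} → Graph n → Fin n → Fin n → ℕ → Set
Dist E x y k = Walk E x y k × (∀ m → Walk E x y m → k ≤ m)

IsSimpleGraph : ∀ {n} → Graph n → Set
IsSimpleGraph E = (∀ x y → E x y → E y x) × (∀ x → ¬ E x x)

Delete : ∀ {n} → Graph n → List (Fin n × Fin n) → Graph n
Delete G0 dels x y = G0 x y × ¬ ((x , y) ∈ dels) × ¬ ((y , x) ∈ dels)

Cycle : ∀ {n} → Graph n → Set
Cycle {n} E = Σ (List (Fin n)) λ xs →
  3 ≤ length xs × Unique xs × Linked E (xs ++ take 1 xs)

IsTree : ∀ {n} → (Fin n → Set) → Graph n → Set
IsTree V E =
    (∀ x y → E x y → E y x)
  × (∀ x → ¬ E x x)
  × (∀ x y → E x y → V x × V y)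
  × (∀ x y → V x → V y → ∃ λ k → Walk E x y k)
  × ¬ Cycle E

InBFS : ∀ {n} → Graph n → Fin n → ℕ → Fin n → Set
InBFS G0 s X v = ∃ λ k → Dist G0 v s k × k ≤ X

-- A BFS tree of G0 rooted at s up to depth X, given by parent pointers:
-- every node v at distance k+1 ≤ X from s has as parent a G0-neighbour at
-- distance k from s.  (The root, at distance 0, has no parent.)
record BFSTree {n : ℕ} (G0 : Graph n) (s : Fin n) (X : ℕ) : Set where
  field
    parent : Fin n → Fin n
    parent-ok : ∀ v k → Dist G0 v s (suc k) → suc k ≤ X →
                G0 v (parent v) × Dist G0 (parent v) s k
open BFSTree public

NonRoot : ∀ {n} → Graph n → Fin n → ℕ → Fin n → Set
NonRoot G0 s X u = ∃ λ k → Dist G0 u s (suc k) × suc k ≤ X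

Removed : ∀ {n} {G0 : Graph n} {s : Fin n} {X : ℕ} →
          BFSTree G0 s X → List (Fin n × Fin n) → Fin n → Set
Removed T0 dels u = ((u , parent T0 u) ∈ dels) ⊎ ((parent T0 u , u) ∈ dels)

InU : ∀ {n} {G0 : Graph n} {s : Fin n} {X : ℕ} →
      BFSTree G0 s X → List (Fin n × Fin n) → Fin n → Set
InU {G0 = G0} {s} {X} T0 dels u = NonRoot G0 s X u × Removed T0 dels u

-- A successful run of RepairTree: for every u ∈ U the breadth-first search
-- found the node q u with (1) d_G0(q u , s) < d_G0(u , s) and
-- (2) d_G(u , q u) ≤ δ, where G is the current graph.
SearchesSucceed : ∀ {n} (G0 : Graph n) (s : Fin n) (X δ : ℕ) →
  BFSTree G0 s X → List (Fin n × Fin n) → (Fin n → Fin n) → Set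
SearchesSucceed G0 s X δ T0 dels q = ∀ u → InU T0 dels u →
    (∃ λ ku → ∃ λ kv → Dist G0 u s ku × Dist G0 (q u) s kv × kv < ku)
  × (∃ λ k → Dist (Delete G0 dels) u (q u) k × k ≤ δ)

ParentEdge : ∀ {n} {G0 : Graph n} {s : Fin n} {X : ℕ} →
  BFSTree G0 s X → List (Fin n × Fin n) → (Fin n → Fin n) → Graph n
ParentEdge {G0 = G0} {s} {X} T0 dels q u w = NonRoot G0 s X u ×
  ((¬ Removed T0 dels u × w ≡ parent T0 u) ⊎ (Removed T0 dels u × w ≡ q u))

RepairedTree : ∀ {n} {G0 : Graph n} {s : Fin n} {X : ℕ} →
  BFSTree G0 s X → List (Fin n × Fin n) → (Fin n → Fin n) → Graph n
RepairedTree T0 dels q x y = ParentEdge T0 dels q x y ⊎ ParentEdge T0 dels q y x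

-- T is given by parent pointers: every non-root node u of T0 has exactly
-- one parent, its old T0-parent if that edge survived and otherwise the node
-- q u found by the search, and in both cases the parent is strictly closer
-- to s in G0.
--
-- A walk without backtracking that once steps down to a child keeps
--    stepping down, and one whose last step goes up always went up; going
--    once around a cycle and one step further is such a walk whose first and
--    last steps coincide, so it is monotone and returns to its start.
--  * Module Repair: the parent of each node is well defined and closer to
--    s, every node of T0 reaches s by following parents (induction on the
--    distance), hence any two nodes are connected through s.
-- lemma7 combines the two.
module Submission where

open import Defs
open import Data.Nat using (ℕ; zero; suc; _+_; _≤_; _<_; s≤s)
open import Data.Nat.Properties using (≤-antisym; ≤-trans; ≤-refl; <-irrefl; <⇒≤; ≤-pred)
open import Data.Nat.Induction using (<-rec)
open import Data.Fin using (Fin)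
open import Data.Fin.Properties using (_≟_)
open import Data.Product using (_×_; ∃; ∃₂; _,_; proj₁; proj₂)
open import Data.Product.Properties using (≡-dec)
open import Data.Sum using (_⊎_; inj₁; inj₂)
open import Data.Empty using (⊥; ⊥-elim)
open import Data.Unit using (⊤)
open import Data.List using (List; []; _∷_; _++_; length)
open import Data.List.Membership.Propositional using (_∈_)
open import Data.List.Membership.Propositional.Properties using (∈-++⁺ʳ)
import Data.List.Membership.DecPropositional as DecMembership
open import Data.List.Relation.Unary.All using (All; _∷_)
import Data.List.Relation.Unary.All as All
open import Data.List.Relation.Unary.AllPairs using (_∷_)
open import Data.List.Relation.Unary.Any using (here; there)
open import Data.List.Relation.Unary.Linked using (Linked; [-]; _∷_)
import Data.List.Relation.Unary.Linked as Linked
open import Data.List.Relation.Unary.Linked.Properties using (Linked⇒AllPairs)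
open import Data.List.Relation.Unary.Unique.Propositional using (Unique)
open import Function using (flip)
open import Relation.Nullary using (¬_; Dec; yes; no)
open import Relation.Nullary.Decidable using (_⊎-dec_)
open import Relation.Binary.PropositionalEquality using (_≡_; _≢_; refl; trans; sym; ≢-sym)

Reachable : ∀ {n} → Graph n → Fin n → Fin n → Set
Reachable E x y = ∃ λ k → Walk E x y k

module _ {n : ℕ} {E : Graph n} where

  walk-++ : ∀ {x y z k m} → Walk E x y k → Walk E y z m → Walk E x z (k + m)
  walk-++ here        w′ = w′
  walk-++ (step e w)  w′ = step e (walk-++ w w′)

  reachable-trans : ∀ {x y z} → Reachable E x y → Reachable E y z → Reachable E x z
  reachable-trans (k , w) (m , w′) = k + m , walk-++ w w′

  walk-reverse : (∀ x y → E x y → E y x) → ∀ {x y k} → Walk E x y k → Reachable E y x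
  walk-reverse E-sym here = 0 , here
  walk-reverse E-sym (step {x} {y} e w) =
    reachable-trans (walk-reverse E-sym w) (1 , step (E-sym x y e) here)

linked-no-return : ∀ {A : Set} {T : A → A → Set} →
  (∀ {a b c} → T a b → T b c → T a c) → (∀ {a} → ¬ T a a) →
  ∀ {a ys} → Linked T (a ∷ ys) → a ∈ ys → ⊥
linked-no-return T-trans T-irrefl linked a∈ys with Linked⇒AllPairs T-trans linked
... | T-a ∷ _ = T-irrefl (All.lookup T-a a∈ys)

linked-snoc : ∀ {A : Set} {R : A → A → Set} {a b} (l : List A) →
  Linked R (l ++ a ∷ []) → R a b → Linked R (l ++ a ∷ b ∷ [])
linked-snoc []          _          r = r ∷ [-]
linked-snoc (_ ∷ [])    (e ∷ [-])  r = e ∷ r ∷ [-]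
linked-snoc (_ ∷ z ∷ l) (e ∷ es)   r = e ∷ linked-snoc (z ∷ l) es r

-- Graphs given by parent pointers.  Parent a b says that b is the parent of
-- a; parents are unique and strictly closer to the root (b ≺ a).
module ParentPointers {n : ℕ} (Parent _≺_ : Graph n)
  (parent-unique : ∀ {a b c} → Parent a b → Parent a c → b ≡ c)
  (parent-≺ : ∀ {a b} → Parent a b → b ≺ a)
  (≺-trans : ∀ {a b c} → a ≺ b → b ≺ c → a ≺ c)
  (≺-irrefl : ∀ {a} → ¬ a ≺ a) where

  Edge Child : Graph n
  Edge a b  = Parent a b ⊎ Parent b a
  Child a b = Parent b a

  edge-sym : ∀ a b → Edge a b → Edge b a
  edge-sym _ _ (inj₁ p) = inj₂ p
  edge-sym _ _ (inj₂ p) = inj₁ p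

  not-mutual : ∀ {a b} → Parent a b → Parent b a → ⊥
  not-mutual pab pba = ≺-irrefl (≺-trans (parent-≺ pab) (parent-≺ pba))

  no-loop : ∀ a → ¬ Edge a a
  no-loop _ (inj₁ p) = not-mutual p p
  no-loop _ (inj₂ p) = not-mutual p p

  NoBacktrack : List (Fin n) → Set
  NoBacktrack (a ∷ b ∷ c ∷ l) = a ≢ c × NoBacktrack (b ∷ c ∷ l)
  NoBacktrack _               = ⊤

  LastStep : Graph n → List (Fin n) → Set
  LastStep R (a ∷ b ∷ [])    = R a b
  LastStep R (_ ∷ b ∷ c ∷ l) = LastStep R (b ∷ c ∷ l)
  LastStep R _               = ⊥

  lastStep-++ : ∀ {R a b} (l : List (Fin n)) → R a b → LastStep R (l ++ a ∷ b ∷ [])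
  lastStep-++     []              r = r
  lastStep-++     (_ ∷ [])        r = r
  lastStep-++     (_ ∷ _ ∷ [])    r = r
  lastStep-++ {R} (_ ∷ y ∷ z ∷ l) r = lastStep-++ {R} (y ∷ z ∷ l) r

  -- Once a walk without backtracking steps to a child it only steps to
  -- children: stepping to the parent would go back, parents being unique.
  child-walk : ∀ {a y l} → Parent y a → Linked Edge (y ∷ l) →
               NoBacktrack (a ∷ y ∷ l) → Linked Child (a ∷ y ∷ l)
  child-walk pya [-]              _            = pya ∷ [-]
  child-walk pya (inj₁ pyz ∷ _)   (a≢z , _)    = ⊥-elim (a≢z (parent-unique pya pyz))
  child-walk pya (inj₂ pzy ∷ es)  (_ , nb)     = pya ∷ child-walk pzy es nb

  down-not-up : ∀ {l} → Linked Child l → ¬ LastStep Parent l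
  down-not-up (c ∷ [-])          p    = not-mutual p c
  down-not-up (_ ∷ cs@(_ ∷ _))   last = down-not-up cs last

  parent-walk : ∀ {l} → Linked Edge l → NoBacktrack l → LastStep Parent l →
                Linked Parent l
  parent-walk (inj₁ p ∷ [-])        _        _    = p ∷ [-]
  parent-walk (inj₁ p ∷ es@(_ ∷ _)) (_ , nb) last = p ∷ parent-walk es nb last
  parent-walk (inj₂ p ∷ es)         nb       last =
    ⊥-elim (down-not-up (child-walk p es nb) last)

  -- The lap x0 x1 … x(m-1) x0 x1 of a cycle x0 … x(m-1) with m ≥ 3 (once
  -- around, then the first step again) has no backtracking.  Inside the
  -- cycle this is uniqueness of its nodes; the two windows closing the lap
  -- need x0 and x1 to differ from the last two nodes, which wrap tracks.
  lap-noBacktrack : ∀ x0 x1 x2 rest → Unique (x0 ∷ x1 ∷ x2 ∷ rest) →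
                    NoBacktrack (x0 ∷ x1 ∷ x2 ∷ rest ++ x0 ∷ x1 ∷ [])
  lap-noBacktrack x0 x1 x2 rest (x0≢@(_ ∷ x0≢x2 ∷ _) ∷ x1≢ ∷ uniq) =
    x0≢x2 , wrap x1 x2 rest (x1≢ ∷ uniq) x0≢ x1≢
    where
    wrap : ∀ {x y} a b l → Unique (a ∷ b ∷ l) → All (x ≢_) (a ∷ b ∷ l) →
           All (y ≢_) (b ∷ l) → NoBacktrack (a ∷ b ∷ l ++ x ∷ y ∷ [])
    wrap a b [] _ (x≢a ∷ _) (y≢b ∷ _) = ≢-sym x≢a , ≢-sym y≢b , _
    wrap a b (c ∷ l) ((_ ∷ a≢c ∷ _) ∷ u) (_ ∷ x≢) (_ ∷ y≢) =
      a≢c , wrap b c l u x≢ y≢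

  -- The undirected graph of parent pointers has no cycle: the lap around
  -- it starts and ends with the same step, so by child-walk or parent-walk
  -- it is monotone for ≺, yet it returns to its first node.
  no-cycle : ¬ Cycle Edge
  no-cycle ([] , () , _)
  no-cycle (_ ∷ [] , s≤s () , _)
  no-cycle (_ ∷ _ ∷ [] , s≤s (s≤s ()) , _)
  no-cycle (xs@(x0 ∷ x1 ∷ x2 ∷ rest) , _ , uniq , cycle) = lap-impossible (Linked.head cycle)
    where
    lap : Edge x0 x1 → Linked Edge (x0 ∷ x1 ∷ x2 ∷ rest ++ x0 ∷ x1 ∷ [])
    lap = linked-snoc xs cycle

    nb : NoBacktrack (x0 ∷ x1 ∷ x2 ∷ rest ++ x0 ∷ x1 ∷ [])
    nb = lap-noBacktrack x0 x1 x2 rest uniq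

    returns : x0 ∈ x1 ∷ x2 ∷ rest ++ x0 ∷ x1 ∷ []
    returns = there (there (∈-++⁺ʳ rest (here refl)))

    lap-impossible : Edge x0 x1 → ⊥
    lap-impossible e@(inj₁ p01) = linked-no-return (flip ≺-trans) ≺-irrefl
      (Linked.map parent-≺ (parent-walk (lap e) nb (lastStep-++ xs p01))) returns
    lap-impossible e@(inj₂ p10) = linked-no-return ≺-trans ≺-irrefl
      (Linked.map parent-≺ (child-walk p10 (Linked.tail (lap e)) nb)) returns

module Repair {n : ℕ} (G0 : Graph n) (s : Fin n) (X δ : ℕ) (T0 : BFSTree G0 s X)
  (dels : List (Fin n × Fin n)) (q : Fin n → Fin n)
  (searches : SearchesSucceed G0 s X δ T0 dels q) where

  Depth : Fin n → ℕ → Set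
  Depth x k = Dist G0 x s k

  depth-unique : ∀ {x k m} → Depth x k → Depth x m → k ≡ m
  depth-unique (w , k-min) (w′ , m-min) = ≤-antisym (k-min _ w′) (m-min _ w)

  Within : Fin n → ℕ → Set
  Within x k = ∃ λ m → Depth x m × m ≤ k

  _≺_ : Graph n
  a ≺ b = ∃₂ λ ka kb → Depth a ka × Depth b kb × ka < kb

  ≺-trans : ∀ {a b c} → a ≺ b → b ≺ c → a ≺ c
  ≺-trans (ka , kb , da , db , ka<kb) (kb′ , kc , db′ , dc , kb′<kc)
    with depth-unique db db′
  ... | refl = ka , kc , da , dc , ≤-trans ka<kb (<⇒≤ kb′<kc)

  ≺-irrefl : ∀ {a} → ¬ a ≺ a
  ≺-irrefl (ka , ka′ , da , da′ , ka<ka′) with depth-unique da da′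
  ... | refl = <-irrefl refl ka<ka′

  Parent : Graph n
  Parent = ParentEdge T0 dels q

  parent-unique : ∀ {a b c} → Parent a b → Parent a c → b ≡ c
  parent-unique (_ , inj₁ (_ , b≡)) (_ , inj₁ (_ , c≡)) = trans b≡ (sym c≡)
  parent-unique (_ , inj₁ (kept , _)) (_ , inj₂ (removed , _)) = ⊥-elim (kept removed)
  parent-unique (_ , inj₂ (removed , _)) (_ , inj₁ (kept , _)) = ⊥-elim (kept removed)
  parent-unique (_ , inj₂ (_ , b≡)) (_ , inj₂ (_ , c≡)) = trans b≡ (sym c≡)

  -- The parent of a node at depth k + 1 lies within depth k: the T0-parent
  -- by the BFS property, the new parent q u by condition (1) of the search.
  parent-closer : ∀ {u w k} → Parent u w → Depth u (suc k) → Within w k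
  parent-closer {u} {k = k} ((_ , du′ , k<X) , inj₁ (_ , refl)) du
    with depth-unique du′ du
  ... | refl = k , proj₂ (parent-ok T0 u k du k<X) , ≤-refl
  parent-closer {u} (nonRoot , inj₂ (removed , refl)) du
    with proj₁ (searches u (nonRoot , removed))
  ... | _ , kq , du′ , dq , kq<ku with depth-unique du′ du
  ... | refl = kq , dq , ≤-pred kq<ku

  parent-≺ : ∀ {u w} → Parent u w → w ≺ u
  parent-≺ pe@((k , du , _) , _) with parent-closer pe du
  ... | kw , dw , kw≤k = kw , suc k , dw , du , s≤s kw≤k

  parent-in-T0 : ∀ {u w} → Parent u w → InBFS G0 s X u × InBFS G0 s X w
  parent-in-T0 pe@((k , du , k<X) , _) with parent-closer pe du
  ... | kw , dw , kw≤k = (suc k , du , k<X) , (kw , dw , ≤-trans kw≤k (<⇒≤ k<X))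

  open DecMembership (≡-dec (_≟_ {n}) (_≟_ {n})) using (_∈?_)

  removed? : ∀ u → Dec (Removed T0 dels u)
  removed? u = ((u , parent T0 u) ∈? dels) ⊎-dec ((parent T0 u , u) ∈? dels)

  parent-exists : ∀ {u} → NonRoot G0 s X u → ∃ (Parent u)
  parent-exists {u} nonRoot with removed? u
  ... | yes removed = q u , nonRoot , inj₂ (removed , refl)
  ... | no kept     = parent T0 u , nonRoot , inj₁ (kept , refl)

  open ParentPointers Parent _≺_ parent-unique parent-≺ ≺-trans ≺-irrefl
    using (Edge; edge-sym; no-loop; no-cycle)

  edge-in-T0 : ∀ x y → Edge x y → InBFS G0 s X x × InBFS G0 s X y
  edge-in-T0 _ _ (inj₁ pe) = parent-in-T0 pe
  edge-in-T0 _ _ (inj₂ pe) = let (inW , inU) = parent-in-T0 pe in inU , inW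

  reaches-root : ∀ {x} → InBFS G0 s X x → Reachable Edge x s
  reaches-root (k , dx , k≤X) = <-rec ClimbsFrom climb k _ dx k≤X
    where
    ClimbsFrom : ℕ → Set
    ClimbsFrom k = ∀ x → Depth x k → k ≤ X → Reachable Edge x s

    climb : ∀ k → (∀ {j} → j < k → ClimbsFrom j) → ClimbsFrom k
    climb zero    _   _ (here , _) _   = 0 , here
    climb (suc k) rec x dx k<X with parent-exists (k , dx , k<X)
    ... | w , pe with parent-closer pe dx
    ... | kw , dw , kw≤k =
      reachable-trans (1 , step (inj₁ pe) here)
        (rec (s≤s kw≤k) w dw (≤-trans kw≤k (<⇒≤ k<X)))

  connected : ∀ x y → InBFS G0 s X x → InBFS G0 s X y → Reachable Edge x y
  connected _ _ inX inY =
    reachable-trans (reaches-root inX) (walk-reverse edge-sym (proj₂ (reaches-root inY)))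

  is-tree : IsTree (InBFS G0 s X) Edge
  is-tree = edge-sym , no-loop , edge-in-T0 , connected , no-cycle

lemma7 : (n : ℕ) (G0 : Graph n) (s : Fin n) (κ X δ : ℕ) →
    1 ≤ κ → 1 ≤ X → 1 ≤ δ → IsSimpleGraph G0 →
    (T0 : BFSTree G0 s X) →
    (dels : List (Fin n × Fin n)) → 1 ≤ length dels → length dels < κ →
    (q : Fin n → Fin n) → SearchesSucceed G0 s X δ T0 dels q →
    IsTree (InBFS G0 s X) (RepairedTree T0 dels q)
lemma7 n G0 s κ X δ _ _ _ _ T0 dels _ _ q searches =
  Repair.is-tree G0 s X δ T0 dels q searches
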